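{- Let $G$ be a non-complete double-critical $7$-chromatic graph. If $x$ is a vertex of degree $9$ in $G$, then the complement $\overline{G_x}$ of the neighbourhood graph $G_x=G[N(x)]$ does not contain $K_4^-$ (the complete graph on four vertices with one edge removed) as a subgraph.
   Context: All graphs are finite and simple. A graph $G$ is (vertex-)critical if $\chi(G-v)<\chi(G)$ for every vertex $v$. A critical graph $G$ is double-critical if $\chi(G-x-y)\le \chi(G)-2$ for every edge $xy\in E(G)$ (here $G-x-y$ denotes deletion of both end-vertices). -}

module Defs where

open import Data.Nat using (ℕ; zero; suc; _+_)
open import Data.Fin using (Fin)
open import Data.Bool using (Bool; true; false; if_then_else_)
open import Data.List using (List; map; allFin)
open import Data.Nat.ListAction using (sum)
open import Data.Product using (∃; ∃-syntax; _×_; _,_)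
open import Relation.Binary.PropositionalEquality using (_≡_; _≢_)
open import Relation.Nullary using (¬_)

record Graph (n : ℕ) : Set where
  field
    adj     : Fin n → Fin n → Bool
    sym     : ∀ u v → adj u v ≡ adj v u
    irrefl  : ∀ v → adj v v ≡ false

open Graph public

Adj : ∀ {n} → Graph n → Fin n → Fin n → Set
Adj G u v = adj G u v ≡ true

VSet : ℕ → Set
VSet n = Fin n → Bool

all : ∀ {n} → VSet n
all _ = true

_∖_ : ∀ {n} → VSet n → Fin n → VSet n
(S ∖ x) v with v Data.Fin.≟ x
... | Relation.Nullary.yes _ = false
... | Relation.Nullary.no  _ = S v

Colourable : ∀ {n} → Graph n → VSet n → ℕ → Set
Colourable {n} G S k =
  Data.Product.Σ (Fin n → Fin k) λ c → (∀ (u v : Fin n) → S u ≡ true → S v ≡ true → Adj G u v →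
          c u ≢ c v)

ChromaticNumber : ∀ {n} → Graph n → VSet n → ℕ → Set
ChromaticNumber G S k = Colourable G S k × (∀ j → Colourable G S j → k Data.Nat.≤ j)

Chromatic : ∀ {n} → Graph n → ℕ → Set
Chromatic G k = ChromaticNumber G all k

ChiLe : ∀ {n} → Graph n → VSet n → ℕ → Set
ChiLe G S m = ∃[ j ] (ChromaticNumber G S j × j Data.Nat.≤ m)

DoubleCriticalChromatic : ∀ {n} → Graph n → ℕ → Set
DoubleCriticalChromatic {n} G k =
  Chromatic G k ×
  (∀ (v : Fin n) → ∃[ j ] (ChromaticNumber G (all ∖ v) j × suc j Data.Nat.≤ k)) ×
  (∀ (x y : Fin n) → Adj G x y → ChiLe G ((all ∖ x) ∖ y) (k Data.Nat.∸ 2))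

Complete : ∀ {n} → Graph n → Set
Complete {n} G = ∀ (u v : Fin n) → u ≢ v → Adj G u v

degree : ∀ {n} → Graph n → Fin n → ℕ
degree {n} G x = sum (map (λ v → if adj G x v then 1 else 0) (allFin n))

-- The complement of the neighbourhood graph G_x = G[N(x)] contains K₄⁻
-- as a (not necessarily induced) subgraph: there are four distinct
-- neighbours a, b, c, d of x such that all pairs except possibly {c,d}
-- are edges of the complement, i.e. non-adjacent in G.
ComplNbhdHasK4Minus : ∀ {n} → Graph n → Fin n → Set
ComplNbhdHasK4Minus {n} G x =
  ∃[ a ] ∃[ b ] ∃[ c ] ∃[ d ]
    ( (a ≢ b × a ≢ c × a ≢ d × b ≢ c × b ≢ d × c ≢ d)
    × (Adj G x a × Adj G x b × Adj G x c × Adj G x d)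
    × (¬ Adj G a b × ¬ Adj G a c × ¬ Adj G a d × ¬ Adj G b c × ¬ Adj G b d) )

module Submission where

-- Let x have degree 9 and let a, b, c, d ∈ N(x) span a K₄⁻ in the
-- complement of G[N(x)], the missing complement edge being cd; so a and b are
-- non-adjacent to each other and to c, d.
--   * Key lemma (double-critical graphs): if xy is an edge and χ(G) = m + 2, then
--     G - x - y has a proper m-colouring, and every colour of such a colouring
--     occurs in N(x) ∩ N(y).  Otherwise the vertices of a missing colour i that
--     are adjacent to y join a fresh class with x, y takes colour i, and G would
--     be (m+1)-colourable.
--   * Colouring G - x - a this way, the colour of b occurs on some common
--     neighbour w of x and a; as b and w lie in G - x - a, w is not adjacent to b.
--   * Colouring G - x - b, the five colours give five distinct common neighbours
--     of x and b.  Together with a, b, c, d, w (five distinct neighbours of x not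
--     adjacent to b) this yields ten distinct neighbours of x: contradiction.

open import Defs
open import Data.Nat using (ℕ; zero; suc; _+_; _≤_; z≤n; s≤s; s≤s⁻¹)
open import Data.Nat.Properties using (+-suc; ≤-antisym; 1+n≰n)
open import Data.Fin using (Fin; zero; suc; _≟_)
open import Data.Fin.Properties using (suc-injective; any?)
open import Data.Bool using (Bool; true; false; if_then_else_)
import Data.Bool as Bool
open import Data.List using (List; []; _∷_; tabulate; length)
open import Data.List.Properties using (map-tabulate; length-tabulate)
open import Data.Nat.ListAction using (sum)
open import Data.List.Relation.Unary.All as All using (All; []; _∷_)
import Data.List.Relation.Unary.All.Properties as All
open import Data.List.Relation.Unary.AllPairs using ([]; _∷_)
open import Data.List.Relation.Unary.Unique.Propositional using (Unique)
import Data.List.Relation.Unary.Unique.Propositional.Properties as Unique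
open import Data.List.Relation.Binary.Disjoint.Propositional using (Disjoint)
open import Data.Product using (Σ; ∃-syntax; _×_; _,_; proj₁; proj₂)
open import Data.Empty using (⊥-elim)
open import Function using (_∘_)
open import Relation.Binary.PropositionalEquality as ≡
  using (_≡_; _≢_; refl; trans; cong; subst; ≢-sym)
open ≡.≡-Reasoning
open import Relation.Nullary using (¬_; Dec; yes; no; contradiction; _×-dec_)

indicator : Bool → ℕ
indicator b = if b then 1 else 0

count : ∀ {n} → (Fin n → Bool) → ℕ
count {zero}  P = 0
count {suc n} P = indicator (P zero) + count (P ∘ suc)

sum-tabulate≡count : ∀ {n} (P : Fin n → Bool) → sum (tabulate (indicator ∘ P)) ≡ count P
sum-tabulate≡count {zero}  P = refl
sum-tabulate≡count {suc n} P = cong (indicator (P zero) +_) (sum-tabulate≡count (P ∘ suc))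

degree≡count : ∀ {n} (G : Graph n) x → degree G x ≡ count (adj G x)
degree≡count {n} G x =
  trans (cong sum (map-tabulate {n = n} (λ v → v) (indicator ∘ adj G x)))
        (sum-tabulate≡count (adj G x))

count-cong : ∀ {n} {P Q : Fin n → Bool} → (∀ v → P v ≡ Q v) → count P ≡ count Q
count-cong {zero}  P≡Q = refl
count-cong {suc n} P≡Q = ≡.cong₂ _+_ (cong indicator (P≡Q zero)) (count-cong (P≡Q ∘ suc))

∖-removed : ∀ {n} (S : VSet n) x → (S ∖ x) x ≡ false
∖-removed S x with x ≟ x
... | yes _   = refl
... | no x≢x = contradiction refl x≢x

∖-kept : ∀ {n} (S : VSet n) {x v} → v ≢ x → (S ∖ x) v ≡ S v
∖-kept S {x} {v} v≢x with v ≟ x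
... | yes v≡x = contradiction v≡x v≢x
... | no _    = refl

count-remove : ∀ {n} (P : VSet n) v → P v ≡ true → count P ≡ suc (count (P ∖ v))
count-remove {suc n} P zero Pv
  rewrite Pv | ∖-removed P zero = cong suc (count-cong λ i → ≡.sym (∖-kept P {zero} {suc i} λ ()))
count-remove {suc n} P (suc v) Pv = begin
  indicator (P zero) + count (P ∘ suc)
    ≡⟨ cong (indicator (P zero) +_) (count-remove (P ∘ suc) v Pv) ⟩
  indicator (P zero) + suc (count ((P ∘ suc) ∖ v))
    ≡⟨ +-suc (indicator (P zero)) _ ⟩
  suc (indicator (P zero) + count ((P ∘ suc) ∖ v))
    ≡⟨ cong suc (≡.cong₂ _+_ (cong indicator (≡.sym (∖-kept P {suc v} {zero} λ ())))
                             (count-cong deleted-agree)) ⟩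
  suc (count (P ∖ suc v)) ∎
  where
  deleted-agree : ∀ i → ((P ∘ suc) ∖ v) i ≡ (P ∖ suc v) (suc i)
  deleted-agree i = by-cases (i ≟ v)
    where
    by-cases : Dec (i ≡ v) → ((P ∘ suc) ∖ v) i ≡ (P ∖ suc v) (suc i)
    by-cases (yes refl) = trans (∖-removed (P ∘ suc) i) (≡.sym (∖-removed P (suc i)))
    by-cases (no i≢v)   = trans (∖-kept (P ∘ suc) i≢v) (≡.sym (∖-kept P (i≢v ∘ suc-injective)))

unique≤count : ∀ {n} (P : Fin n → Bool) {vs} → Unique vs → All (λ v → P v ≡ true) vs →
               length vs ≤ count P
unique≤count P {[]}     []               []         = z≤n
unique≤count P {v ∷ vs} (v∉vs ∷ unique) (Pv ∷ Pvs) =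
  subst (_ ≤_) (≡.sym (count-remove P v Pv))
        (s≤s (unique≤count (P ∖ v) unique (All.zipWith kept (v∉vs , Pvs))))
  where
  kept : ∀ {u} → v ≢ u × P u ≡ true → (P ∖ v) u ≡ true
  kept (v≢u , Pu) = trans (∖-kept P (≢-sym v≢u)) Pu

disjoint-by : ∀ {A : Set} {P : A → Set} {xs ys : List A} →
              All (¬_ ∘ P) xs → All P ys → Disjoint xs ys
disjoint-by ¬Pxs Pys (v∈xs , v∈ys) = All.lookup ¬Pxs v∈xs (All.lookup Pys v∈ys)

ProperOn : ∀ {n k} → Graph n → VSet n → (Fin n → Fin k) → Set
ProperOn G S c = ∀ u v → S u ≡ true → S v ≡ true → Adj G u v → c u ≢ c v

ChiAtLeast : ∀ {n} → Graph n → ℕ → Set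
ChiAtLeast G k = ∀ j → Colourable G all j → k ≤ j

without : ∀ {n} → Fin n → Fin n → VSet n
without x y = (all ∖ x) ∖ y

in-without : ∀ {n} {x y v : Fin n} → v ≢ x → v ≢ y → without x y v ≡ true
in-without v≢x v≢y = trans (∖-kept (all ∖ _) v≢y) (∖-kept all v≢x)

data Role {n} (x y v : Fin n) : Set where
  is-x  : v ≡ x → Role x y v
  is-y  : v ≡ y → Role x y v
  other : v ≢ x → v ≢ y → Role x y v

role : ∀ {n} (x y v : Fin n) → Role x y v
role x y v with v ≟ x | v ≟ y
... | yes v≡x | _       = is-x v≡x
... | no v≢x  | yes v≡y = is-y v≡y
... | no v≢x  | no v≢y  = other v≢x v≢y

module _ {n} (G : Graph n) where

  no-loop : ∀ {v} → ¬ Adj G v v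
  no-loop {v} loop = contradiction (trans (≡.sym loop) (irrefl G v)) λ ()

  adjacent-distinct : ∀ {u v} → Adj G u v → u ≢ v
  adjacent-distinct uv refl = no-loop uv

  adj-sym : ∀ {u v} → Adj G u v → Adj G v u
  adj-sym {u} {v} uv = trans (Graph.sym G v u) uv

  non-neighbour-≢ : ∀ {a v w} → ¬ Adj G a v → Adj G a w → v ≢ w
  non-neighbour-≢ ¬av aw refl = ¬av aw

  extend-by-two : ∀ {j} x y (col : Fin n → Fin j) → ProperOn G (without x y) col →
                  Colourable G all (suc (suc j))
  extend-by-two {j} x y col proper = paint , paint-proper
    where
    paint-by : ∀ {v} → Role x y v → Fin (suc (suc j))
    paint-by (is-x _)        = zero
    paint-by (is-y _)        = suc zero
    paint-by {v} (other _ _) = suc (suc (col v))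

    paint : Fin n → Fin (suc (suc j))
    paint v = paint-by (role x y v)

    paint-proper : ProperOn G all paint
    paint-proper u v _ _ uv with role x y u | role x y v
    ... | is-x refl | is-x refl   = ⊥-elim (no-loop uv)
    ... | is-x _    | is-y _      = λ ()
    ... | is-x _    | other _ _   = λ ()
    ... | is-y _    | is-x _      = λ ()
    ... | is-y refl | is-y refl   = ⊥-elim (no-loop uv)
    ... | is-y _    | other _ _   = λ ()
    ... | other _ _ | is-x _      = λ ()
    ... | other _ _ | is-y _      = λ ()
    ... | other u≢x u≢y | other v≢x v≢y =
      proper u v (in-without u≢x u≢y) (in-without v≢x v≢y) uv ∘ suc-injective ∘ suc-injective

  -- Recolouring: if colour i is absent from N(x) ∩ N(y), the i-coloured
  -- neighbours of y join a fresh class with x, y takes colour i, and G is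
  -- (j+1)-colourable.
  recolour-missing : ∀ {j} x y (col : Fin n → Fin j) → ProperOn G (without x y) col →
                     (i : Fin j) → (∀ w → Adj G x w → Adj G y w → col w ≢ i) →
                     Colourable G all (suc j)
  recolour-missing {j} x y col proper i missing = paint , paint-proper
    where
    moves? : ∀ v → Dec (col v ≡ i × Adj G y v)
    moves? v = (col v ≟ i) ×-dec (adj G y v Bool.≟ true)

    shift-by : ∀ {v} → Dec (col v ≡ i × Adj G y v) → Fin (suc j)
    shift-by (yes _)    = zero
    shift-by {v} (no _) = suc (col v)

    shift : Fin n → Fin (suc j)
    shift v = shift-by (moves? v)

    -- the fresh class {x} ∪ (moved vertices) is independent
    shift-vs-x : ∀ {v} → Adj G x v → zero ≢ shift v
    shift-vs-x {v} xv with moves? v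
    ... | yes (colv≡i , yv) = λ _ → missing v xv yv colv≡i
    ... | no _              = λ ()

    -- the new class of colour i, {y} ∪ (unmoved i-coloured vertices), is independent
    shift-vs-y : ∀ {v} → Adj G y v → suc i ≢ shift v
    shift-vs-y {v} yv with moves? v
    ... | yes _       = λ ()
    ... | no ¬moved = λ i≡colv → ¬moved (≡.sym (suc-injective i≡colv) , yv)

    shift-proper : ∀ {u v} → without x y u ≡ true → without x y v ≡ true → Adj G u v →
                   shift u ≢ shift v
    shift-proper {u} {v} Su Sv uv with moves? u | moves? v
    ... | yes (colu≡i , _) | yes (colv≡i , _) = λ _ → proper u v Su Sv uv (trans colu≡i (≡.sym colv≡i))
    ... | yes _ | no _ = λ ()
    ... | no _  | yes _ = λ ()
    ... | no _  | no _ = proper u v Su Sv uv ∘ suc-injective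

    paint-by : ∀ {v} → Role x y v → Fin (suc j)
    paint-by (is-x _)        = zero
    paint-by (is-y _)        = suc i
    paint-by {v} (other _ _) = shift v

    paint : Fin n → Fin (suc j)
    paint v = paint-by (role x y v)

    paint-proper : ProperOn G all paint
    paint-proper u v _ _ uv with role x y u | role x y v
    ... | is-x refl | is-x refl   = ⊥-elim (no-loop uv)
    ... | is-x _    | is-y _      = λ ()
    ... | is-x refl | other _ _   = shift-vs-x uv
    ... | is-y _    | is-x _      = λ ()
    ... | is-y refl | is-y refl   = ⊥-elim (no-loop uv)
    ... | is-y refl | other _ _   = shift-vs-y uv
    ... | other _ _ | is-x refl   = shift-vs-x (adj-sym uv) ∘ ≡.sym
    ... | other _ _ | is-y refl   = shift-vs-y (adj-sym uv) ∘ ≡.sym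
    ... | other u≢x u≢y | other v≢x v≢y = shift-proper (in-without u≢x u≢y) (in-without v≢x v≢y) uv

  CoversCommonNbhd : ∀ {j} → Fin n → Fin n → (Fin n → Fin j) → Set
  CoversCommonNbhd x y col = ∀ i → ∃[ w ] (Adj G x w × Adj G y w × col w ≡ i)

  colours-cover : ∀ {j} x y (col : Fin n → Fin j) → ProperOn G (without x y) col →
                  ChiAtLeast G (suc (suc j)) → CoversCommonNbhd x y col
  colours-cover x y col proper χ≥j+2 i
    with any? (λ w → (adj G x w Bool.≟ true) ×-dec (adj G y w Bool.≟ true) ×-dec (col w ≟ i))
  ... | yes (w , xw , yw , colw≡i) = w , xw , yw , colw≡i
  ... | no none = contradiction (χ≥j+2 _ (recolour-missing x y col proper i absent)) 1+n≰n
    where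
    absent : ∀ w → Adj G x w → Adj G y w → col w ≢ i
    absent w xw yw colw≡i = none (w , xw , yw , colw≡i)

  covering-colouring : ∀ {m} x y → ChiAtLeast G (suc (suc m)) → ChiLe G (without x y) m →
                       Σ (Fin n → Fin m) λ col → ProperOn G (without x y) col × CoversCommonNbhd x y col
  covering-colouring x y χ≥m+2 (j , ((col , proper) , _) , j≤m)
    with ≤-antisym j≤m (s≤s⁻¹ (s≤s⁻¹ (χ≥m+2 _ (extend-by-two x y col proper))))
  ... | refl = col , proper , colours-cover x y col proper χ≥m+2

  common-non-neighbour : ∀ {j} x y (col : Fin n → Fin j) → ProperOn G (without x y) col →
                         CoversCommonNbhd x y col → ∀ b → b ≢ x → b ≢ y →
                         ∃[ w ] (Adj G x w × Adj G y w × ¬ Adj G b w)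
  common-non-neighbour x y col proper covers b b≢x b≢y
    with w , xw , yw , colw≡colb ← covers (col b) =
    w , xw , yw , λ bw → proper b w (in-without b≢x b≢y) (in-without w≢x w≢y) bw (≡.sym colw≡colb)
    where
    w≢x : w ≢ x
    w≢x = ≢-sym (adjacent-distinct xw)
    w≢y : w ≢ y
    w≢y = ≢-sym (adjacent-distinct yw)

  covering-neighbours : ∀ {m x y} {col : Fin n → Fin m} → CoversCommonNbhd x y col →
                        Σ (Fin m → Fin n) λ u → (∀ {i i′} → u i ≡ u i′ → i ≡ i′) ×
                                              (∀ i → Adj G x (u i)) × (∀ i → Adj G y (u i))
  covering-neighbours {m} {col = col} covers = u , u-injective , (proj₁ ∘ proj₂ ∘ covers) , (proj₁ ∘ proj₂ ∘ proj₂ ∘ covers)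
    where
    u : Fin m → Fin n
    u = proj₁ ∘ covers
    u-injective : ∀ {i i′} → u i ≡ u i′ → i ≡ i′
    u-injective {i} {i′} ui≡ui′ =
      trans (≡.sym (proj₂ (proj₂ (proj₂ (covers i))))) (trans (cong col ui≡ui′) (proj₂ (proj₂ (proj₂ (covers i′)))))

  distinct-neighbours≤degree : ∀ x {vs} → Unique vs → All (Adj G x) vs → length vs ≤ degree G x
  distinct-neighbours≤degree x unique nbrs =
    subst (_ ≤_) (≡.sym (degree≡count G x)) (unique≤count (adj G x) unique nbrs)

  -- Counting in N(x): a, b, c, d, w are five distinct neighbours of x outside
  -- N(b), and u lists m distinct neighbours of x inside N(b).
  K₄⁻-neighbourhood-bound :
    ∀ {m} x a b c d w (u : Fin m → Fin n) →
    (a ≢ b × a ≢ c × a ≢ d × b ≢ c × b ≢ d × c ≢ d) →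
    (Adj G x a × Adj G x b × Adj G x c × Adj G x d) →
    (¬ Adj G a b × ¬ Adj G a c × ¬ Adj G a d × ¬ Adj G b c × ¬ Adj G b d) →
    Adj G x w → Adj G a w → ¬ Adj G b w →
    (∀ {i i′} → u i ≡ u i′ → i ≡ i′) → (∀ i → Adj G x (u i)) → (∀ i → Adj G b (u i)) →
    5 + m ≤ degree G x
  K₄⁻-neighbourhood-bound x a b c d w u (a≢b , a≢c , a≢d , b≢c , b≢d , c≢d) (xa , xb , xc , xd)
                          (¬ab , ¬ac , ¬ad , ¬bc , ¬bd) xw aw ¬bw u-injective xu bu =
    subst (λ k → 5 + k ≤ degree G x) (length-tabulate u)
          (distinct-neighbours≤degree x
            (Unique.++⁺ outside-unique (Unique.tabulate⁺ u-injective) (disjoint-by outside inside))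
            (xa ∷ xb ∷ xc ∷ xd ∷ xw ∷ All.tabulate⁺ xu))
    where
    outside-unique : Unique (a ∷ b ∷ c ∷ d ∷ w ∷ [])
    outside-unique = (a≢b ∷ a≢c ∷ a≢d ∷ adjacent-distinct aw ∷ [])
                   ∷ (b≢c ∷ b≢d ∷ non-neighbour-≢ ¬ab aw ∷ [])
                   ∷ (c≢d ∷ non-neighbour-≢ ¬ac aw ∷ [])
                   ∷ (non-neighbour-≢ ¬ad aw ∷ [])
                   ∷ [] ∷ []
    outside : All (¬_ ∘ Adj G b) (a ∷ b ∷ c ∷ d ∷ w ∷ [])
    outside = ¬ab ∘ adj-sym ∷ no-loop ∷ ¬bc ∷ ¬bd ∷ ¬bw ∷ []
    inside : All (Adj G b) (tabulate u)
    inside = All.tabulate⁺ bu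

proposition26 : ∀ {n : ℕ} (G : Graph n) → DoubleCriticalChromatic G 7 → ¬ Complete G →
                  (x : Fin n) → degree G x ≡ 9 → ¬ ComplNbhdHasK4Minus G x
proposition26 G ((_ , χ≥7) , _ , double-critical) _ x deg≡9
  (a , b , c , d , distinct@(a≢b , _) , adjacent@(xa , xb , _) , non-adjacent)
  with colA , properA , coversA ← covering-colouring G x a χ≥7 (double-critical x a xa)
     | _ , _ , coversB ← covering-colouring G x b χ≥7 (double-critical x b xb)
  with w , xw , aw , ¬bw ← common-non-neighbour G x a colA properA coversA b
                              (≢-sym (adjacent-distinct G xb)) (≢-sym a≢b)
     | u , u-injective , xu , bu ← covering-neighbours G coversB
  = 1+n≰n (subst (10 ≤_) deg≡9
      (K₄⁻-neighbourhood-bound G x a b c d w u distinct adjacent non-adjacent xw aw ¬bw u-injective xu bu))
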